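{- Let $C$ be an $n$-separable necklace with $n$ colors, each color having an odd number of points. Then 2-Thief-Necklace-Splitting on $C$ has a unique solution.
   Context: A necklace is a set $C$ of pairwise disjoint finite nonempty subsets of $\mathbb{R}$ (called colors). A necklace $C$ is $k$-separable if for every $A\subseteq C$ there exist real numbers $s_1<\dots<s_k$ such that, labelling the intervals $(-\infty,s_1],[s_1,s_2],\dots,[s_{k-1},s_k],[s_k,\infty)$ alternately $A,\bar A,A,\dots$, every interval labelled $A$ is disjoint from $\bigcup_{c\in C\setminus A}c$ and every interval labelled $\bar A$ is disjoint from $\bigcup_{c\in A}c$. A solution to 2-Thief-Necklace-Splitting on a necklace $C$ with $n$ colors is a set of $n$ split points $q_1<\dots<q_n$ in $\mathbb{R}$ such that, labelling the open intervals $(-\infty,q_1),(q_1,q_2),\dots,(q_n,\infty)$ alternately $A^+$ and $A^-$, for every color $c$ the union of the intervals labelled $A^+$ contains the same number of points of $c$ as the union of the intervals labelled $A^-$.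
   Formalization: The points of every color, the separators in the definition of separability, and the split points of a solution are rational rather than real. -}

module Defs where

open import Data.Nat using (ℕ; zero; suc; _%_; _≥_; _≟_)
open import Data.Fin using (Fin; zero; suc; toℕ) renaming (_<_ to _<ᶠ_)
open import Data.Fin.Subset using (Subset; _∈_; _∉_)
open import Data.Rational using (ℚ; _<_; _≤_; _<?_)
open import Data.List using (List; length; filter; map; allFin)
open import Data.Nat.ListAction using (sum)
open import Data.List.Membership.Propositional renaming (_∈_ to _∈ˡ_; _∉_ to _∉ˡ_)
open import Data.List.Relation.Unary.Unique.Propositional using (Unique)
open import Data.Bool using (Bool; true; false; _∧_; T; if_then_else_)
open import Data.Unit using (⊤)
open import Data.Product using (Σ; _×_; ∃)
open import Relation.Nullary using (¬_; does; T?)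
open import Relation.Binary.PropositionalEquality using (_≡_; _≢_)

-- A necklace with n colors, points in ℚ (only the order of
-- the points matters).  Color i is the finite set of points  col i,
-- given as a duplicate-free list.
record Necklace (n : ℕ) : Set where
  field
    col      : Fin n → List ℚ
    unique   : ∀ i → Unique (col i)
    nonempty : ∀ i → length (col i) ≥ 1
    disjoint : ∀ i j (x : ℚ) → i ≢ j → x ∈ˡ col i → x ∉ˡ col j
open Necklace public

StrictlyIncreasing : ∀ {k} → (Fin k → ℚ) → Set
StrictlyIncreasing s = ∀ i j → i <ᶠ j → s i < s j

-- Interval index j : Fin (suc k) is even  <=>  labelled A (resp. A⁺).
EvenIdx : ∀ {k} → Fin (suc k) → Set
EvenIdx j = toℕ j % 2 ≡ 0

-- Closed intervals (-∞,s₁],[s₁,s₂],…,[s_k,∞) ; index j, 0-based.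
ClosedLower : ∀ {k} → (Fin k → ℚ) → Fin (suc k) → ℚ → Set
ClosedLower s zero    x = ⊤
ClosedLower s (suc i) x = s i ≤ x

ClosedUpper : ∀ {k} → (Fin k → ℚ) → Fin (suc k) → ℚ → Set
ClosedUpper {zero}  s zero    x = ⊤
ClosedUpper {suc k} s zero    x = x ≤ s zero
ClosedUpper {suc k} s (suc j) x = ClosedUpper (λ i → s (suc i)) j x

InClosed : ∀ {k} → (Fin k → ℚ) → Fin (suc k) → ℚ → Set
InClosed s j x = ClosedLower s j x × ClosedUpper s j x

Separable : ∀ {n} → ℕ → Necklace n → Set
Separable {n} k C =
  ∀ (A : Subset n) → ∃ λ (s : Fin k → ℚ) →
    StrictlyIncreasing s ×
    (∀ (j : Fin (suc k)) (c : Fin n) (x : ℚ) → x ∈ˡ col C c → InClosed s j x →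
       (EvenIdx j → c ∈ A) × (¬ EvenIdx j → c ∉ A))

openLower : ∀ {k} → (Fin k → ℚ) → Fin (suc k) → ℚ → Bool
openLower q zero    x = true
openLower q (suc i) x = does (q i <? x)

openUpper : ∀ {k} → (Fin k → ℚ) → Fin (suc k) → ℚ → Bool
openUpper {zero}  q zero    x = true
openUpper {suc k} q zero    x = does (x <? q zero)
openUpper {suc k} q (suc j) x = openUpper (λ i → q (suc i)) j x

inOpen : ∀ {k} → (Fin k → ℚ) → Fin (suc k) → ℚ → Bool
inOpen q j x = openLower q j x ∧ openUpper q j x

countIn : ∀ {k} → (Fin k → ℚ) → Fin (suc k) → List ℚ → ℕ
countIn q j xs = length (filter (λ x → T? (inOpen q j x)) xs)

isEvenᵇ : ℕ → Bool
isEvenᵇ m = does (m % 2 ≟ 0)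

-- points of xs in the union of the intervals labelled A⁺ (even index),
-- resp. A⁻ (odd index); the open intervals are pairwise disjoint.
countPlus : ∀ {k} → (Fin k → ℚ) → List ℚ → ℕ
countPlus {k} q xs =
  sum (map (λ j → if isEvenᵇ (toℕ j) then countIn q j xs else 0) (allFin (suc k)))

countMinus : ∀ {k} → (Fin k → ℚ) → List ℚ → ℕ
countMinus {k} q xs =
  sum (map (λ j → if isEvenᵇ (toℕ j) then 0 else countIn q j xs) (allFin (suc k)))

IsSolution : ∀ {n} → Necklace n → (Fin n → ℚ) → Set
IsSolution {n} C q =
  StrictlyIncreasing q × (∀ (c : Fin n) → countPlus q (col C c) ≡ countMinus q (col C c))

-- A solution must put a split point on a point of every colour: a colour that no split
-- point touches is shared evenly between the thieves, yet it has an odd number of points.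
-- As there are n split points and n colours, the split points lie on points of pairwise
-- distinct colours.  Now let x be a point of colour c and q k the split point on c.  The
-- split points together with x are n + 1 coloured points; if x and q k had ranks of equal
-- parity among them, a sequence separating the colours whose points have odd rank would
-- have to put consecutive points into intervals of alternating parity, which needs n + 1
-- separators.  So the points of c below q k lie in intervals of one parity and those above
-- in intervals of the other: c is split evenly exactly when q k is the median of c.  The
-- unique solution is the increasing enumeration of the medians of the colours.
module Submission where

open import Defs
open import Data.Nat using (ℕ; _%_)
open import Data.Fin using (Fin)
open import Data.Rational using (ℚ)
open import Data.List using (length)
open import Data.Product using (Σ; _×_)
open import Relation.Binary.PropositionalEquality using (_≡_)

open import Data.Bool using (Bool; true; false; not; _∧_; if_then_else_; T)
open import Data.Bool.Properties using (not-¬; ¬-not; not-involutive; ∧-zeroʳ; ∧-identityʳ)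
open import Data.Empty using (⊥-elim)
open import Data.Fin using (zero; suc; toℕ; punchOut; fromℕ<)
import Data.Fin.Properties as Fin
open import Data.Fin.Subset using (Subset) renaming (_∈_ to _∈ₛ_; _∉_ to _∉ₛ_)
open import Data.List using (List; []; _∷_; filter; map; tabulate; allFin)
open import Data.List.Membership.Propositional using (_∈_; _∉_; find)
open import Data.List.Membership.Propositional.Properties using (∈-tabulate⁺; ∈-tabulate⁻)
open import Data.List.Properties
  using ( length-filter; filter-accept; filter-reject; filter-notAll; filter-none
        ; tabulate-cong; map-tabulate; map-cong; length-tabulate )
open import Data.List.Relation.Unary.All as All using (All; _∷_)
open import Data.List.Relation.Unary.All.Properties using () renaming (tabulate⁺ to All-tabulate⁺)
open import Data.List.Relation.Unary.AllPairs using (_∷_)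
open import Data.List.Relation.Unary.Any as Any using (here; there; any?)
open import Data.List.Relation.Unary.Unique.Propositional using (Unique)
open import Data.List.Relation.Unary.Unique.Propositional.Properties using () renaming (tabulate⁺ to Unique-tabulate⁺)
open import Data.Nat using (suc; zero; _+_; _*_; z≤n; s≤s; _≟_) renaming (_≤_ to _≤ℕ_; _<_ to _<ℕ_)
open import Data.Nat.ListAction using (sum)
import Data.Nat.Properties as ℕ
open import Algebra.Properties.CommutativeSemigroup ℕ.+-commutativeSemigroup using (interchange; x∙yz≈y∙xz)
open import Data.Product using (∃; _,_; proj₁; proj₂)
open import Data.Rational using (_<_; _≤_; _<?_)
import Data.Rational.Properties as ℚ
open import Data.List.Membership.DecPropositional ℚ._≟_ using (_∈?_)
open import Data.Unit using (tt)
open import Data.Vec using (lookup) renaming (tabulate to tabulateᵥ)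
open import Data.Vec.Properties using ([]=⇒lookup; lookup⇒[]=; lookup∘tabulate)
open import Function using (_∘_; _⇔_; mk⇔; Equivalence)
open import Relation.Binary.Definitions using (tri<; tri≈; tri>)
open import Relation.Binary.PropositionalEquality
  using (_≢_; refl; sym; trans; cong; cong₂; subst; subst₂; ≢-sym; module ≡-Reasoning)
open import Relation.Nullary using (¬_; yes; no; does; contradiction; T?)
open import Relation.Nullary.Decidable using (dec-true; dec-false; _×-dec_)
open import Relation.Unary using (Pred; Decidable; _⊆_)

-- Counting and parity

count : ∀ {a p} {A : Set a} {P : Pred A p} → Decidable P → List A → ℕ
count P? xs = length (filter P? xs)

module _ {a p q} {A : Set a} {P : Pred A p} {Q : Pred A q} (P? : Decidable P) (Q? : Decidable Q) where

  count-mono : P ⊆ Q → ∀ xs → count P? xs ≤ℕ count Q? xs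
  count-mono P⊆Q []       = z≤n
  count-mono P⊆Q (x ∷ xs) with P? x | Q? x
  ... | yes _  | yes _  = s≤s (count-mono P⊆Q xs)
  ... | yes px | no ¬qx = ⊥-elim (¬qx (P⊆Q px))
  ... | no _   | yes _  = ℕ.m≤n⇒m≤1+n (count-mono P⊆Q xs)
  ... | no _   | no _   = count-mono P⊆Q xs

  count-strict : P ⊆ Q → ∀ {w xs} → w ∈ xs → ¬ P w → Q w → count P? xs <ℕ count Q? xs
  count-strict P⊆Q {xs = x ∷ xs} (here refl) ¬pw qw with P? x | Q? x
  ... | yes pw | _      = ⊥-elim (¬pw pw)
  ... | no _   | yes _  = s≤s (count-mono P⊆Q xs)
  ... | no _   | no ¬qw = ⊥-elim (¬qw qw)
  count-strict P⊆Q {xs = x ∷ xs} (there w∈xs) ¬pw qw with P? x | Q? x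
  ... | yes _  | yes _  = s≤s (count-strict P⊆Q w∈xs ¬pw qw)
  ... | yes px | no ¬qx = ⊥-elim (¬qx (P⊆Q px))
  ... | no _   | yes _  = ℕ.m≤n⇒m≤1+n (count-strict P⊆Q w∈xs ¬pw qw)
  ... | no _   | no _   = count-strict P⊆Q w∈xs ¬pw qw

𝟙 : Bool → ℕ
𝟙 true  = 1
𝟙 false = 0

count-T? : ∀ {a} {A : Set a} (p : A → Bool) xs → count (T? ∘ p) xs ≡ sum (map (𝟙 ∘ p) xs)
count-T? p []       = refl
count-T? p (x ∷ xs) with p x
... | true  = cong suc (count-T? p xs)
... | false = count-T? p xs

sum-map+sum-map : ∀ {a} {A : Set a} (f g : A → ℕ) xs → (∀ {x} → x ∈ xs → f x + g x ≡ 1) →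
  sum (map f xs) + sum (map g xs) ≡ length xs
sum-map+sum-map f g []       f+g≡1 = refl
sum-map+sum-map f g (x ∷ xs) f+g≡1 =
  trans (interchange (f x) _ (g x) _) (cong₂ _+_ (f+g≡1 (here refl)) (sum-map+sum-map f g xs (f+g≡1 ∘ there)))

sum-tabulate-zero : ∀ {m} (f : Fin m → ℕ) → (∀ j → f j ≡ 0) → sum (tabulate f) ≡ 0
sum-tabulate-zero {zero}  f f≡0 = refl
sum-tabulate-zero {suc m} f f≡0 rewrite f≡0 zero = sum-tabulate-zero (f ∘ suc) (f≡0 ∘ suc)

sum-tabulate-+ : ∀ {m} (f g : Fin m → ℕ) → sum (tabulate (λ j → f j + g j)) ≡ sum (tabulate f) + sum (tabulate g)
sum-tabulate-+ {zero}  f g = refl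
sum-tabulate-+ {suc m} f g =
  trans (cong (f zero + g zero +_) (sum-tabulate-+ (f ∘ suc) (g ∘ suc))) (interchange (f zero) (g zero) _ _)

sum-tabulate-map-comm : ∀ {a} {A : Set a} {m} (h : Fin m → A → ℕ) xs →
  sum (tabulate (λ j → sum (map (h j) xs))) ≡ sum (map (λ x → sum (tabulate (λ j → h j x))) xs)
sum-tabulate-map-comm {m = m} h []       = sum-tabulate-zero {m} _ (λ _ → refl)
sum-tabulate-map-comm         h (x ∷ xs) =
  trans (sum-tabulate-+ (λ j → h j x) (λ j → sum (map (h j) xs)))
        (cong (sum (tabulate (λ j → h j x)) +_) (sum-tabulate-map-comm h xs))

isEvenᵇ-suc : ∀ m → isEvenᵇ (suc m) ≡ not (isEvenᵇ m)
isEvenᵇ-suc zero          = refl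
isEvenᵇ-suc (suc zero)    = refl
isEvenᵇ-suc (suc (suc m)) = isEvenᵇ-suc m

isEvenᵇ-double : ∀ h → isEvenᵇ (h + h) ≡ true
isEvenᵇ-double zero    = refl
isEvenᵇ-double (suc h) rewrite ℕ.+-suc h h = isEvenᵇ-double h

%2≡1⇒odd : ∀ m → m % 2 ≡ 1 → ∃ λ h → m ≡ suc (h + h)
%2≡1⇒odd (suc zero)    _     = zero , refl
%2≡1⇒odd (suc (suc m)) m%2≡1 =
  let (h , m≡) = %2≡1⇒odd m m%2≡1 in suc h , cong (λ t → suc (suc t)) (trans m≡ (sym (ℕ.+-suc h h)))

%2≡1⇒isEvenᵇ≡false : ∀ m → m % 2 ≡ 1 → isEvenᵇ m ≡ false
%2≡1⇒isEvenᵇ≡false m m%2≡1 rewrite m%2≡1 = refl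

isEvenᵇ≡true⇒%2≡0 : ∀ m → isEvenᵇ m ≡ true → m % 2 ≡ 0
isEvenᵇ≡true⇒%2≡0 m even with m % 2 ≟ 0
... | yes m%2≡0 = m%2≡0
... | no m%2≢0  = contradiction (trans (sym even) (dec-false (m % 2 ≟ 0) m%2≢0)) λ ()

isEvenᵇ≡false⇒%2≢0 : ∀ m → isEvenᵇ m ≡ false → m % 2 ≢ 0
isEvenᵇ≡false⇒%2≢0 m odd m%2≡0 = contradiction (trans (sym (dec-true (m % 2 ≟ 0) m%2≡0)) odd) λ ()

double-injective : ∀ {a b} → a + a ≡ b + b → a ≡ b
double-injective {a} {b} a+a≡b+b with ℕ.<-cmp a b
... | tri< a<b _ _ = ⊥-elim (ℕ.<⇒≢ (ℕ.+-mono-< a<b a<b) a+a≡b+b)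
... | tri≈ _ a≡b _ = a≡b
... | tri> _ _ b<a = ⊥-elim (ℕ.<⇒≢ (ℕ.+-mono-< b<a b<a) (sym a+a≡b+b))

-- Ranks and medians

rank : List ℚ → ℚ → ℕ
rank xs x = count (_<? x) xs

above : List ℚ → ℚ → ℕ
above xs x = count (x <?_) xs

rank-∷-< : ∀ {z x} zs → z < x → rank (z ∷ zs) x ≡ suc (rank zs x)
rank-∷-< zs z<x = cong length (filter-accept (_<? _) z<x)

rank-∷-≮ : ∀ {z x} zs → ¬ z < x → rank (z ∷ zs) x ≡ rank zs x
rank-∷-≮ zs z≮x = cong length (filter-reject (_<? _) z≮x)

above-∷-< : ∀ {z x} zs → x < z → above (z ∷ zs) x ≡ suc (above zs x)
above-∷-< zs x<z = cong length (filter-accept (_ <?_) x<z)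

above-∷-≮ : ∀ {z x} zs → ¬ x < z → above (z ∷ zs) x ≡ above zs x
above-∷-≮ zs x≮z = cong length (filter-reject (_ <?_) x≮z)

rank-mono : ∀ xs {x y} → x ≤ y → rank xs x ≤ℕ rank xs y
rank-mono xs x≤y = count-mono (_<? _) (_<? _) (λ z<x → ℚ.<-≤-trans z<x x≤y) xs

rank-strict : ∀ {xs x y} → x ∈ xs → x < y → rank xs x <ℕ rank xs y
rank-strict x∈xs x<y = count-strict (_<? _) (_<? _) (λ z<x → ℚ.<-trans z<x x<y) x∈xs (ℚ.<-irrefl refl) x<y

rank-cancel-< : ∀ xs {x y} → rank xs x <ℕ rank xs y → x < y
rank-cancel-< xs {x} {y} r<r with x <? y
... | yes x<y = x<y
... | no x≮y  = ⊥-elim (ℕ.<⇒≱ r<r (rank-mono xs (ℚ.≮⇒≥ x≮y)))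

rank-injective : ∀ {xs x y} → x ∈ xs → y ∈ xs → rank xs x ≡ rank xs y → x ≡ y
rank-injective {x = x} {y} x∈xs y∈xs r≡r with ℚ.<-cmp x y
... | tri< x<y _ _ = ⊥-elim (ℕ.<⇒≢ (rank-strict x∈xs x<y) r≡r)
... | tri≈ _ x≡y _ = x≡y
... | tri> _ _ y<x = ⊥-elim (ℕ.<⇒≢ (rank-strict y∈xs y<x) (sym r≡r))

rank<length : ∀ {xs x} → x ∈ xs → rank xs x <ℕ length xs
rank<length {xs} x∈xs = filter-notAll (_<? _) xs (Any.map (λ { refl → ℚ.<-irrefl refl }) x∈xs)

rank-surjective : ∀ {xs} → Unique xs → ∀ {k} → k <ℕ length xs → ∃ λ x → x ∈ xs × rank xs x ≡ k
rank-surjective {z ∷ zs} (z∉zs ∷ uniq) {k} k<len with ℕ.<-cmp k (rank zs z)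
... | tri< k<r _ _ =
  let (x , x∈zs , rx) = rank-surjective uniq (ℕ.<-≤-trans k<r (length-filter (_<? z) zs))
      x<z = rank-cancel-< zs (subst (_<ℕ rank zs z) (sym rx) k<r)
  in x , there x∈zs , trans (rank-∷-≮ zs (ℚ.<-asym x<z)) rx
... | tri≈ _ k≡r _ = z , here refl , trans (rank-∷-≮ zs (ℚ.<-irrefl refl)) (sym k≡r)
rank-surjective {z ∷ zs} (z∉zs ∷ uniq) {suc k′} (s≤s k′<len) | tri> _ _ (s≤s r≤k′) =
  let (x , x∈zs , rx) = rank-surjective uniq k′<len
  in x , there x∈zs , trans (rank-∷-< zs (z<x x∈zs (subst (rank zs z ≤ℕ_) (sym rx) r≤k′))) (cong suc rx)
  where
  z<x : ∀ {x} → x ∈ zs → rank zs z ≤ℕ rank zs x → z < x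
  z<x {x} x∈zs r≤r with ℚ.<-cmp z x
  ... | tri< z<x _ _  = z<x
  ... | tri≈ _ refl _ = ⊥-elim (All.lookup z∉zs x∈zs refl)
  ... | tri> _ _ x<z  = ⊥-elim (ℕ.<⇒≱ (rank-strict x∈zs x<z) r≤r)

rank+above : ∀ {x} xs → x ∉ xs → rank xs x + above xs x ≡ length xs
rank+above []       _  = refl
rank+above {x} (y ∷ ys) x∉ with ℚ.<-cmp y x
... | tri< y<x _ _ rewrite rank-∷-< ys y<x | above-∷-≮ ys (ℚ.<-asym y<x) =
  cong suc (rank+above ys (x∉ ∘ there))
... | tri≈ _ y≡x _ = ⊥-elim (x∉ (here (sym y≡x)))
... | tri> _ _ x<y rewrite rank-∷-≮ ys (ℚ.<-asym x<y) | above-∷-< ys x<y =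
  trans (ℕ.+-suc _ _) (cong suc (rank+above ys (x∉ ∘ there)))

rank+above-∈ : ∀ {x xs} → Unique xs → x ∈ xs → suc (rank xs x + above xs x) ≡ length xs
rank+above-∈ {x} {_ ∷ ys} (x∉ys ∷ _) (here refl)
  rewrite rank-∷-≮ ys (ℚ.<-irrefl {x} refl) | above-∷-≮ ys (ℚ.<-irrefl {x} refl) =
  cong suc (rank+above ys (λ x∈ys → All.lookup x∉ys x∈ys refl))
rank+above-∈ {x} {y ∷ ys} (y∉ys ∷ uniq) (there x∈ys) with ℚ.<-cmp y x
... | tri< y<x _ _ rewrite rank-∷-< ys y<x | above-∷-≮ ys (ℚ.<-asym y<x) =
  cong suc (rank+above-∈ uniq x∈ys)
... | tri≈ _ refl _ = ⊥-elim (All.lookup y∉ys x∈ys refl)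
... | tri> _ _ x<y rewrite rank-∷-≮ ys (ℚ.<-asym x<y) | above-∷-< ys x<y =
  cong suc (trans (ℕ.+-suc _ _) (rank+above-∈ uniq x∈ys))

sum-map-by-side : ∀ (f : ℚ → ℕ) m {u v} xs →
  (∀ {x} → x ∈ xs → x < m → f x ≡ u) → (∀ {x} → x ∈ xs → m < x → f x ≡ v) → f m ≡ 0 →
  sum (map f xs) ≡ rank xs m * u + above xs m * v
sum-map-by-side f m []       f-below f-above f-at = refl
sum-map-by-side f m {u} {v} (y ∷ ys) f-below f-above f-at
  with ℚ.<-cmp y m | sum-map-by-side f m ys (f-below ∘ there) (f-above ∘ there) f-at
... | tri< y<m _ _ | ih rewrite rank-∷-< ys y<m | above-∷-≮ ys (ℚ.<-asym y<m) =
  trans (cong₂ _+_ (f-below (here refl) y<m) ih) (sym (ℕ.+-assoc u _ _))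
... | tri≈ _ refl _ | ih rewrite rank-∷-≮ ys (ℚ.<-irrefl {y} refl) | above-∷-≮ ys (ℚ.<-irrefl {y} refl) =
  cong₂ _+_ f-at ih
... | tri> _ _ m<y | ih rewrite rank-∷-≮ ys (ℚ.<-asym m<y) | above-∷-< ys m<y =
  trans (cong₂ _+_ (f-above (here refl) m<y) ih) (x∙yz≈y∙xz v (rank ys m * u) (above ys m * v))

alternating⇒rank< : ∀ {Z} → Unique Z → (f : ℚ → ℕ) → (∀ {x y} → x ≤ y → f x ≤ℕ f y) →
  (∀ {z} → z ∈ Z → isEvenᵇ (f z) ≡ not (isEvenᵇ (rank Z z))) →
  ∀ {z} → z ∈ Z → rank Z z <ℕ f z
alternating⇒rank< {Z} uniq f mono alternating z∈Z = go _ z∈Z refl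
  where
  parity : ∀ {z r} → z ∈ Z → rank Z z ≡ r → isEvenᵇ (f z) ≡ not (isEvenᵇ r)
  parity z∈Z rank≡r = trans (alternating z∈Z) (cong (not ∘ isEvenᵇ) rank≡r)

  go : ∀ r {z} → z ∈ Z → rank Z z ≡ r → r <ℕ f z
  go zero    z∈Z rank≡0 =
    ℕ.n≢0⇒n>0 λ fz≡0 → contradiction (trans (cong isEvenᵇ (sym fz≡0)) (parity z∈Z rank≡0)) λ ()
  go (suc r) {z} z∈Z rank≡1+r =
    let (z′ , z′∈Z , rank≡r) = rank-surjective uniq (subst (_≤ℕ length Z) rank≡1+r (ℕ.<⇒≤ (rank<length z∈Z)))
        z′<z = rank-cancel-< Z (subst₂ _<ℕ_ (sym rank≡r) (sym rank≡1+r) (ℕ.n<1+n r))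
        fz′≢fz : f z′ ≢ f z
        fz′≢fz fz′≡fz = not-¬ refl (begin
          not (isEvenᵇ r)       ≡⟨ sym (parity z′∈Z rank≡r) ⟩
          isEvenᵇ (f z′)        ≡⟨ cong isEvenᵇ fz′≡fz ⟩
          isEvenᵇ (f z)         ≡⟨ parity z∈Z rank≡1+r ⟩
          not (isEvenᵇ (suc r)) ≡⟨ cong not (isEvenᵇ-suc r) ⟩
          not (not (isEvenᵇ r)) ∎)
    in ℕ.≤-<-trans (go r z′∈Z rank≡r) (ℕ.≤∧≢⇒< (mono (ℚ.<⇒≤ z′<z)) fz′≢fz)
    where open ≡-Reasoning

IsMedian : List ℚ → ℚ → Set
IsMedian xs m = m ∈ xs × rank xs m ≡ above xs m

median-unique : ∀ {xs m m′} → Unique xs → IsMedian xs m → IsMedian xs m′ → m ≡ m′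
median-unique {xs} {m} {m′} uniq (m∈xs , r≡a) (m′∈xs , r′≡a′) =
  rank-injective m∈xs m′∈xs (double-injective (ℕ.suc-injective (begin
    suc (rank xs m + rank xs m)    ≡⟨ cong (λ t → suc (rank xs m + t)) r≡a ⟩
    suc (rank xs m + above xs m)   ≡⟨ rank+above-∈ uniq m∈xs ⟩
    length xs                      ≡⟨ sym (rank+above-∈ uniq m′∈xs) ⟩
    suc (rank xs m′ + above xs m′) ≡⟨ cong (λ t → suc (rank xs m′ + t)) (sym r′≡a′) ⟩
    suc (rank xs m′ + rank xs m′)  ∎)))
  where open ≡-Reasoning

median-exists : ∀ {xs h} → Unique xs → length xs ≡ suc (h + h) → ∃ (IsMedian xs)
median-exists {xs} {h} uniq length≡ =
  let (m , m∈xs , rank≡h) = rank-surjective uniq (subst (h <ℕ_) (sym length≡) (s≤s (ℕ.m≤m+n h h)))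
      h+a≡h+h = ℕ.suc-injective (begin
        suc (h + above xs m)         ≡⟨ cong (λ r → suc (r + above xs m)) (sym rank≡h) ⟩
        suc (rank xs m + above xs m) ≡⟨ rank+above-∈ uniq m∈xs ⟩
        length xs                    ≡⟨ length≡ ⟩
        suc (h + h)                  ∎)
  in m , m∈xs , trans rank≡h (sym (ℕ.+-cancelˡ-≡ h _ _ h+a≡h+h))
  where open ≡-Reasoning

-- Increasing sequences

increasing-tail : ∀ {k} {q : Fin (suc k) → ℚ} → StrictlyIncreasing q → StrictlyIncreasing (q ∘ suc)
increasing-tail inc i j i<j = inc (suc i) (suc j) (s≤s i<j)

increasing-mono : ∀ {k} {q : Fin k → ℚ} → StrictlyIncreasing q → ∀ {i j} → toℕ i ≤ℕ toℕ j → q i ≤ q j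
increasing-mono inc {i} {j} i≤j with Fin.<-cmp i j
... | tri< i<j _ _  = ℚ.<⇒≤ (inc i j i<j)
... | tri≈ _ refl _ = ℚ.≤-refl
... | tri> _ _ j<i  = ⊥-elim (ℕ.<⇒≱ j<i i≤j)

increasing-injective : ∀ {k} {q : Fin k → ℚ} → StrictlyIncreasing q → ∀ {i j} → q i ≡ q j → i ≡ j
increasing-injective inc {i} {j} qᵢ≡qⱼ with Fin.<-cmp i j
... | tri< i<j _ _ = ⊥-elim (ℚ.<-irrefl qᵢ≡qⱼ (inc i j i<j))
... | tri≈ _ i≡j _ = i≡j
... | tri> _ _ j<i = ⊥-elim (ℚ.<-irrefl (sym qᵢ≡qⱼ) (inc j i j<i))

increasing-unique : ∀ {k} {q q′ : Fin k → ℚ} → StrictlyIncreasing q → StrictlyIncreasing q′ →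
  (∀ i → ∃ λ j → q i ≡ q′ j) → (∀ j → ∃ λ i → q′ j ≡ q i) → ∀ i → q i ≡ q′ i
increasing-unique {suc k} {q} {q′} inc inc′ q⊆q′ q′⊆q = go
  where
  heads : q zero ≡ q′ zero
  heads = ℚ.≤-antisym
    (ℚ.≤-trans (increasing-mono inc z≤n) (ℚ.≤-reflexive (sym (proj₂ (q′⊆q zero)))))
    (ℚ.≤-trans (increasing-mono inc′ z≤n) (ℚ.≤-reflexive (sym (proj₂ (q⊆q′ zero)))))
  tail⊆ : ∀ {p p′ : Fin (suc k) → ℚ} → StrictlyIncreasing p → p zero ≡ p′ zero →
    (∀ i → ∃ λ j → p i ≡ p′ j) → ∀ i → ∃ λ j → p (suc i) ≡ p′ (suc j)
  tail⊆ inc heads p⊆p′ i with p⊆p′ (suc i)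
  ... | zero  , pᵢ≡p′₀ = ⊥-elim (ℚ.<-irrefl (trans heads (sym pᵢ≡p′₀)) (inc zero (suc i) (s≤s z≤n)))
  ... | suc j , pᵢ≡p′ⱼ = j , pᵢ≡p′ⱼ
  go : ∀ i → q i ≡ q′ i
  go zero    = heads
  go (suc i) = increasing-unique (increasing-tail inc) (increasing-tail inc′)
    (tail⊆ inc heads q⊆q′) (tail⊆ inc′ (sym heads) q′⊆q) i

record IncreasingEnumeration {m} (xs : List ℚ) (q : Fin m → ℚ) : Set where
  field
    increasing : StrictlyIncreasing q
    member     : ∀ i → q i ∈ xs
    onto       : ∀ {x} → x ∈ xs → ∃ λ i → q i ≡ x

increasing-enumeration : ∀ {xs m} → Unique xs → length xs ≡ m → Σ (Fin m → ℚ) (IncreasingEnumeration xs)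
increasing-enumeration {xs} uniq refl = q , record { increasing = increasing ; member = member ; onto = onto }
  where
  element : ∀ (i : Fin (length xs)) → ∃ λ x → x ∈ xs × rank xs x ≡ toℕ i
  element i = rank-surjective uniq (Fin.toℕ<n i)
  q : Fin (length xs) → ℚ
  q i = proj₁ (element i)
  member : ∀ i → q i ∈ xs
  member i = proj₁ (proj₂ (element i))
  rank-q : ∀ i → rank xs (q i) ≡ toℕ i
  rank-q i = proj₂ (proj₂ (element i))
  increasing : StrictlyIncreasing q
  increasing i j i<j = rank-cancel-< xs (subst₂ _<ℕ_ (sym (rank-q i)) (sym (rank-q j)) i<j)
  onto : ∀ {x} → x ∈ xs → ∃ λ i → q i ≡ x
  onto x∈xs = let i = fromℕ< (rank<length x∈xs) in
    i , rank-injective (member i) x∈xs (trans (rank-q i) (Fin.toℕ-fromℕ< (rank<length x∈xs)))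

injective⇒surjective : ∀ {m} (f : Fin m → Fin m) → (∀ {a b} → f a ≡ f b → a ≡ b) →
  ∀ k → ∃ λ a → f a ≡ k
injective⇒surjective {suc m} f f-injective k with Fin.any? (λ a → f a Fin.≟ k)
... | yes hit = hit
... | no miss = ⊥-elim (ℕ.<-irrefl refl (Fin.injective⇒≤ punched-injective))
  where
  punched : Fin (suc m) → Fin m
  punched a = punchOut {i = k} {j = f a} (λ k≡fa → miss (a , sym k≡fa))
  punched-injective : ∀ {a b} → punched a ≡ punched b → a ≡ b
  punched-injective {a} {b} =
    f-injective ∘ Fin.punchOut-injective (λ k≡fa → miss (a , sym k≡fa)) (λ k≡fb → miss (b , sym k≡fb))

-- Split points and open intervals

position : ∀ {k} → (Fin k → ℚ) → ℚ → Fin (suc k)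
position {zero}  s x = zero
position {suc k} s x with s zero <? x
... | yes _ = suc (position (s ∘ suc) x)
... | no _  = zero

position-mono : ∀ {k} (s : Fin k → ℚ) {x y} → x ≤ y → toℕ (position s x) ≤ℕ toℕ (position s y)
position-mono {zero}  s x≤y = z≤n
position-mono {suc k} s {x} {y} x≤y with s zero <? x | s zero <? y
... | yes _    | yes _   = s≤s (position-mono (s ∘ suc) x≤y)
... | yes s₀<x | no s₀≮y = ⊥-elim (s₀≮y (ℚ.<-≤-trans s₀<x x≤y))
... | no _     | _       = z≤n

position-inClosed : ∀ {k} (s : Fin k → ℚ) x → InClosed s (position s x) x
position-inClosed {zero}  s x = tt , tt
position-inClosed {suc k} s x with s zero <? x
... | yes s₀<x = let (lower , upper) = position-inClosed (s ∘ suc) x in shift _ lower , upper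
  where
  shift : ∀ j → ClosedLower (s ∘ suc) j x → ClosedLower s (suc j) x
  shift zero    _     = ℚ.<⇒≤ s₀<x
  shift (suc j) lower = lower
... | no s₀≮x = tt , ℚ.≮⇒≥ s₀≮x

position-split : ∀ {k} {q : Fin k → ℚ} → StrictlyIncreasing q → ∀ i → toℕ (position q (q i)) ≡ toℕ i
position-split {suc k} {q} inc i with q zero <? q i
position-split {suc k} {q} inc zero    | yes q₀<q₀ = ⊥-elim (ℚ.<-irrefl refl q₀<q₀)
position-split {suc k} {q} inc (suc i) | yes _     = cong suc (position-split (increasing-tail inc) i)
position-split {suc k} {q} inc zero    | no _      = refl
position-split {suc k} {q} inc (suc i) | no q₀≮qᵢ  = ⊥-elim (q₀≮qᵢ (inc zero (suc i) (s≤s z≤n)))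

rank-tabulate : ∀ {k} {q : Fin k → ℚ} → StrictlyIncreasing q → ∀ x → rank (tabulate q) x ≡ toℕ (position q x)
rank-tabulate {zero}      inc x = refl
rank-tabulate {suc k} {q} inc x with q zero <? x
... | yes q₀<x = trans (rank-∷-< _ q₀<x) (cong suc (rank-tabulate (increasing-tail inc) x))
... | no q₀≮x  = trans (rank-∷-≮ _ q₀≮x) (cong length (filter-none (_<? x) (All-tabulate⁺ tail≮x)))
  where
  tail≮x : ∀ i → ¬ q (suc i) < x
  tail≮x i qᵢ<x = q₀≮x (ℚ.≤-<-trans (increasing-mono inc {zero} {suc i} z≤n) qᵢ<x)

inOpen-tail : ∀ {k} {q : Fin (suc k) → ℚ} {x} → q zero < x → ∀ j → inOpen q (suc j) x ≡ inOpen (q ∘ suc) j x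
inOpen-tail {q = q} {x} q₀<x zero    = cong (_∧ openUpper (q ∘ suc) zero x) (dec-true (q zero <? x) q₀<x)
inOpen-tail             q₀<x (suc j) = refl

inOpen-≤head : ∀ {k} {q : Fin (suc k) → ℚ} {x} → StrictlyIncreasing q → x ≤ q zero →
  ∀ j → inOpen q (suc j) x ≡ false
inOpen-≤head {q = q} {x} inc x≤q₀ j = cong (_∧ openUpper q (suc j) x) (dec-false (q j <? x) qⱼ≮x)
  where
  qⱼ≮x : ¬ q j < x
  qⱼ≮x qⱼ<x = ℚ.<-irrefl refl (ℚ.<-≤-trans qⱼ<x (ℚ.≤-trans x≤q₀ (increasing-mono inc {zero} {j} z≤n)))

weight : ∀ {k} → (ℕ → Bool) → (Fin k → ℚ) → ℚ → ℕ
weight {k} E q x = sum (tabulate (λ (j : Fin (suc k)) → 𝟙 (E (toℕ j) ∧ inOpen q j x)))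

labelled-count≡sum-weight : ∀ {k} (E : ℕ → Bool) (q : Fin k → ℚ) xs →
  sum (map (λ j → if E (toℕ j) then countIn q j xs else 0) (allFin (suc k))) ≡ sum (map (weight E q) xs)
labelled-count≡sum-weight {k} E q xs = begin
  sum (map (λ j → if E (toℕ j) then countIn q j xs else 0) (allFin (suc k)))
    ≡⟨ cong sum (map-tabulate (λ j → j) (λ j → if E (toℕ j) then countIn q j xs else 0)) ⟩
  sum (tabulate (λ j → if E (toℕ j) then countIn q j xs else 0))
    ≡⟨ cong sum (tabulate-cong (λ j → if-count (E (toℕ j)) (inOpen q j))) ⟩
  sum (tabulate (λ j → sum (map (λ x → 𝟙 (E (toℕ j) ∧ inOpen q j x)) xs)))
    ≡⟨ sum-tabulate-map-comm (λ j x → 𝟙 (E (toℕ j) ∧ inOpen q j x)) xs ⟩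
  sum (map (weight E q) xs) ∎
  where
  open ≡-Reasoning
  if-count : ∀ b p → (if b then count (T? ∘ p) xs else 0) ≡ sum (map (λ x → 𝟙 (b ∧ p x)) xs)
  if-count true  p = count-T? p xs
  if-count false p = sym (zeros xs)
    where
    zeros : ∀ ys → sum (map (λ y → 𝟙 (false ∧ p y)) ys) ≡ 0
    zeros []       = refl
    zeros (_ ∷ ys) = zeros ys

weight-≤head : ∀ {k} (E : ℕ → Bool) {q : Fin (suc k) → ℚ} {x} → StrictlyIncreasing q → x ≤ q zero →
  weight E q x ≡ 𝟙 (E 0 ∧ does (x <? q zero))
weight-≤head E {q} {x} inc x≤q₀ =
  trans (cong (𝟙 (E 0 ∧ does (x <? q zero)) +_) (sum-tabulate-zero _ tail≡0)) (ℕ.+-identityʳ _)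
  where
  tail≡0 : ∀ j → 𝟙 (E (suc (toℕ j)) ∧ inOpen q (suc j) x) ≡ 0
  tail≡0 j = cong 𝟙 (trans (cong (E (suc (toℕ j)) ∧_) (inOpen-≤head inc x≤q₀ j)) (∧-zeroʳ _))

weight-tail : ∀ {k} (E : ℕ → Bool) {q : Fin (suc k) → ℚ} {x} → q zero < x →
  weight E q x ≡ weight (E ∘ suc) (q ∘ suc) x
weight-tail {k} E {q} {x} q₀<x = cong₂ _+_ head≡0 (cong sum (tabulate-cong {n = suc k} tail≡))
  where
  head≡0 : 𝟙 (E 0 ∧ does (x <? q zero)) ≡ 0
  head≡0 = cong 𝟙 (trans (cong (E 0 ∧_) (dec-false (x <? q zero) (ℚ.<-asym q₀<x))) (∧-zeroʳ _))
  tail≡ : ∀ j → 𝟙 (E (suc (toℕ j)) ∧ inOpen q (suc j) x) ≡ 𝟙 (E (suc (toℕ j)) ∧ inOpen (q ∘ suc) j x)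
  tail≡ j = cong (λ b → 𝟙 (E (suc (toℕ j)) ∧ b)) (inOpen-tail {q = q} q₀<x j)

weight-split : ∀ {k} (E : ℕ → Bool) {q : Fin k → ℚ} → StrictlyIncreasing q → ∀ i → weight E q (q i) ≡ 0
weight-split {suc k} E {q} inc zero =
  trans (weight-≤head E inc ℚ.≤-refl) (cong 𝟙 (trans (cong (E 0 ∧_) q₀≮q₀) (∧-zeroʳ _)))
  where
  q₀≮q₀ : does (q zero <? q zero) ≡ false
  q₀≮q₀ = dec-false (q zero <? q zero) (ℚ.<-irrefl refl)
weight-split {suc k} E {q} inc (suc i) =
  trans (weight-tail E {q} (inc zero (suc i) (s≤s z≤n))) (weight-split (E ∘ suc) (increasing-tail inc) i)

weight-gap : ∀ {k} (E : ℕ → Bool) {q : Fin k → ℚ} {x} → StrictlyIncreasing q → (∀ i → q i ≢ x) →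
  weight E q x ≡ 𝟙 (E (toℕ (position q x)))
weight-gap {zero}  E         inc gap = trans (ℕ.+-identityʳ _) (cong 𝟙 (∧-identityʳ (E 0)))
weight-gap {suc k} E {q} {x} inc gap with q zero <? x
... | yes q₀<x = trans (weight-tail E {q} q₀<x) (weight-gap (E ∘ suc) (increasing-tail inc) (gap ∘ suc))
... | no q₀≮x  =
  trans (weight-≤head E inc (ℚ.≮⇒≥ q₀≮x))
        (cong 𝟙 (trans (cong (E 0 ∧_) (dec-true (x <? q zero) x<q₀)) (∧-identityʳ _)))
  where
  x<q₀ : x < q zero
  x<q₀ with ℚ.<-cmp x (q zero)
  ... | tri< x<q₀ _ _ = x<q₀
  ... | tri≈ _ x≡q₀ _ = ⊥-elim (gap zero (sym x≡q₀))
  ... | tri> _ _ q₀<x = ⊥-elim (q₀≮x q₀<x)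

countPlus≡sum-weight : ∀ {k} (q : Fin k → ℚ) xs → countPlus q xs ≡ sum (map (weight isEvenᵇ q) xs)
countPlus≡sum-weight q xs = labelled-count≡sum-weight isEvenᵇ q xs

countMinus≡sum-weight : ∀ {k} (q : Fin k → ℚ) xs → countMinus q xs ≡ sum (map (weight (not ∘ isEvenᵇ) q) xs)
countMinus≡sum-weight {k} q xs =
  trans (cong sum (map-cong (λ j → if-swap (isEvenᵇ (toℕ j))) (allFin (suc k))))
        (labelled-count≡sum-weight (not ∘ isEvenᵇ) q xs)
  where
  if-swap : ∀ {m} b → (if b then 0 else m) ≡ (if not b then m else 0)
  if-swap true  = refl
  if-swap false = refl

countPlus+countMinus≡length : ∀ {k} {q : Fin k → ℚ} → StrictlyIncreasing q → ∀ xs →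
  (∀ {x} → x ∈ xs → ∀ i → q i ≢ x) → countPlus q xs + countMinus q xs ≡ length xs
countPlus+countMinus≡length {q = q} inc xs gaps =
  trans (cong₂ _+_ (countPlus≡sum-weight q xs) (countMinus≡sum-weight q xs))
        (sum-map+sum-map _ _ xs λ {x} x∈xs →
          trans (cong₂ _+_ (weight-gap isEvenᵇ inc (gaps x∈xs)) (weight-gap (not ∘ isEvenᵇ) inc (gaps x∈xs)))
                (𝟙+𝟙-not (isEvenᵇ (toℕ (position q x)))))
  where
  𝟙+𝟙-not : ∀ b → 𝟙 b + 𝟙 (not b) ≡ 1
  𝟙+𝟙-not true  = refl
  𝟙+𝟙-not false = refl

-- Necklaces

module _ {n} (C : Necklace n) where

  Coloured : ℚ → Set
  Coloured x = ∃ λ c → x ∈ col C c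

  same-colour : ∀ {x c d} → x ∈ col C c → x ∈ col C d → c ≡ d
  same-colour {x} {c} {d} x∈c x∈d with c Fin.≟ d
  ... | yes c≡d = c≡d
  ... | no c≢d  = ⊥-elim (disjoint C c d x c≢d x∈c x∈d)

  Separates : Subset n → (Fin n → ℚ) → Set
  Separates A s = ∀ (j : Fin (suc n)) (c : Fin n) (x : ℚ) → x ∈ col C c → InClosed s j x →
    (EvenIdx j → c ∈ₛ A) × (¬ EvenIdx j → c ∉ₛ A)

  separates⇒parity≡membership : ∀ {A s} → Separates A s → ∀ {c x} → x ∈ col C c →
    isEvenᵇ (toℕ (position s x)) ≡ lookup A c
  separates⇒parity≡membership {A} {s} separates {c} {x} x∈c =
    by-cases (separates (position s x) c x x∈c (position-inClosed s x))
    where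
    p : ℕ
    p = toℕ (position s x)
    by-cases : (p % 2 ≡ 0 → c ∈ₛ A) × (p % 2 ≢ 0 → c ∉ₛ A) → isEvenᵇ p ≡ lookup A c
    by-cases (even⇒∈ , odd⇒∉) with isEvenᵇ p in parity | lookup A c in A[c]
    ... | true  | true  = refl
    ... | false | false = refl
    ... | true  | false = trans (sym ([]=⇒lookup (even⇒∈ (isEvenᵇ≡true⇒%2≡0 p parity)))) A[c]
    ... | false | true  = ⊥-elim (odd⇒∉ (isEvenᵇ≡false⇒%2≢0 p parity) (lookup⇒[]= c A A[c]))

  ParityConsistent : List ℚ → Set
  ParityConsistent Z = ∀ {c z z′} → z ∈ Z → z′ ∈ Z → z ∈ col C c → z′ ∈ col C c →
    isEvenᵇ (rank Z z) ≡ isEvenᵇ (rank Z z′)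

  separable⇒¬parityConsistent : Separable n C → ∀ {Z} → Unique Z → n <ℕ length Z → All Coloured Z →
    ¬ ParityConsistent Z
  separable⇒¬parityConsistent sep {Z} uniq n<length coloured consistent =
    let (top , top∈Z , rank≡n) = rank-surjective uniq n<length
    in ℕ.<-irrefl refl (begin-strict
      n                    ≡⟨ sym rank≡n ⟩
      rank Z top           <⟨ alternating⇒rank< uniq (toℕ ∘ position s) (position-mono s) alternating top∈Z ⟩
      toℕ (position s top) ≤⟨ ℕ.≤-pred (Fin.toℕ<n (position s top)) ⟩
      n                    ∎)
    where
    open ℕ.≤-Reasoning
    oddColour : Fin n → Bool
    oddColour c = does (any? (λ z → z ∈? col C c ×-dec T? (not (isEvenᵇ (rank Z z)))) Z)

    oddColour-∈ : ∀ {c z} → z ∈ Z → z ∈ col C c → oddColour c ≡ not (isEvenᵇ (rank Z z))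
    oddColour-∈ {c} {z} z∈Z z∈c with not (isEvenᵇ (rank Z z)) in parity
    ... | true  = dec-true (any? _ Z) (Any.map (λ { refl → z∈c , subst T (sym parity) tt }) z∈Z)
    ... | false = dec-false (any? _ Z) λ witness →
      let (z′ , z′∈Z , z′∈c , odd′) = find witness
      in subst T (trans (cong not (consistent z′∈Z z∈Z z′∈c z∈c)) parity) odd′

    A : Subset n
    A = tabulateᵥ oddColour

    s : Fin n → ℚ
    s = proj₁ (sep A)

    alternating : ∀ {z} → z ∈ Z → isEvenᵇ (toℕ (position s z)) ≡ not (isEvenᵇ (rank Z z))
    alternating z∈Z =
      let (c , z∈c) = All.lookup coloured z∈Z
      in trans (separates⇒parity≡membership (proj₂ (proj₂ (sep A))) z∈c)
               (trans (lookup∘tabulate oddColour c) (oddColour-∈ z∈Z z∈c))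

  record SplitsOnDistinctColours (q : Fin n → ℚ) : Set where
    field
      increasing       : StrictlyIncreasing q
      coloured         : ∀ i → Coloured (q i)
      colour-injective : ∀ {i j c} → q i ∈ col C c → q j ∈ col C c → i ≡ j

  module SplitOnColour (sep : Separable n C) {q} (splits : SplitsOnDistinctColours q)
                       {c k} (qₖ∈c : q k ∈ col C c) where
    open SplitsOnDistinctColours splits

    gap : ∀ {x} → x ∈ col C c → x ≢ q k → ∀ i → q i ≢ x
    gap x∈c x≢qₖ i qᵢ≡x =
      x≢qₖ (trans (sym qᵢ≡x) (cong q (colour-injective (subst (_∈ col C c) (sym qᵢ≡x) x∈c) qₖ∈c)))

    split-points-of-one-colour : ∀ {z z′ e} → z ∈ tabulate q → z′ ∈ tabulate q →
      z ∈ col C e → z′ ∈ col C e → z ≡ z′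
    split-points-of-one-colour z∈q z′∈q z∈e z′∈e =
      let (i , z≡qᵢ) = ∈-tabulate⁻ z∈q
          (j , z′≡qⱼ) = ∈-tabulate⁻ z′∈q
          i≡j = colour-injective (subst (_∈ col C _) z≡qᵢ z∈e) (subst (_∈ col C _) z′≡qⱼ z′∈e)
      in trans z≡qᵢ (trans (cong q i≡j) (sym z′≡qⱼ))

    parity-flip : ∀ {x} → x ∈ col C c → x ≢ q k →
      isEvenᵇ (toℕ (position q x)) ≡ not (isEvenᵇ (rank (x ∷ tabulate q) (q k)))
    parity-flip {x} x∈c x≢qₖ =
      trans (cong isEvenᵇ (sym rank-x))
            (¬-not λ same → separable⇒¬parityConsistent sep Z-unique n<length all-coloured (consistent same))
      where
      Z : List ℚ
      Z = x ∷ tabulate q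
      rank-x : rank Z x ≡ toℕ (position q x)
      rank-x = trans (rank-∷-≮ (tabulate q) (ℚ.<-irrefl {x} refl)) (rank-tabulate increasing x)
      Z-unique : Unique Z
      Z-unique = All-tabulate⁺ (λ i x≡qᵢ → gap x∈c x≢qₖ i (sym x≡qᵢ))
               ∷ Unique-tabulate⁺ (increasing-injective increasing)
      n<length : n <ℕ length Z
      n<length = s≤s (ℕ.≤-reflexive (sym (length-tabulate q)))
      all-coloured : All Coloured Z
      all-coloured = (c , x∈c) ∷ All-tabulate⁺ coloured
      is-qₖ : ∀ {z e} → z ∈ tabulate q → z ∈ col C e → x ∈ col C e → z ≡ q k
      is-qₖ z∈q z∈e x∈e =
        split-points-of-one-colour z∈q (∈-tabulate⁺ k) z∈e (subst (λ d → q k ∈ col C d) (same-colour x∈c x∈e) qₖ∈c)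
      consistent : isEvenᵇ (rank Z x) ≡ isEvenᵇ (rank Z (q k)) → ParityConsistent Z
      consistent same (here refl) (here refl)  _   _    = refl
      consistent same (here refl) (there z′∈q) x∈e z′∈e =
        trans same (cong (isEvenᵇ ∘ rank Z) (sym (is-qₖ z′∈q z′∈e x∈e)))
      consistent same (there z∈q) (here refl)  z∈e x∈e  =
        trans (cong (isEvenᵇ ∘ rank Z) (is-qₖ z∈q z∈e x∈e)) (sym same)
      consistent same (there z∈q) (there z′∈q) z∈e z′∈e =
        cong (isEvenᵇ ∘ rank Z) (split-points-of-one-colour z∈q z′∈q z∈e z′∈e)

    rank-split-point : rank (tabulate q) (q k) ≡ toℕ k
    rank-split-point = trans (rank-tabulate increasing (q k)) (position-split increasing k)

    parity-below : ∀ {x} → x ∈ col C c → x < q k → isEvenᵇ (toℕ (position q x)) ≡ isEvenᵇ (toℕ k)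
    parity-below {x} x∈c x<qₖ = begin
      isEvenᵇ (toℕ (position q x))                ≡⟨ parity-flip x∈c (ℚ.<⇒≢ x<qₖ) ⟩
      not (isEvenᵇ (rank (x ∷ tabulate q) (q k)))
        ≡⟨ cong (not ∘ isEvenᵇ) (trans (rank-∷-< _ x<qₖ) (cong suc rank-split-point)) ⟩
      not (isEvenᵇ (suc (toℕ k)))                 ≡⟨ cong not (isEvenᵇ-suc (toℕ k)) ⟩
      not (not (isEvenᵇ (toℕ k)))                 ≡⟨ not-involutive _ ⟩
      isEvenᵇ (toℕ k)                             ∎
      where open ≡-Reasoning

    parity-above : ∀ {x} → x ∈ col C c → q k < x → isEvenᵇ (toℕ (position q x)) ≡ not (isEvenᵇ (toℕ k))
    parity-above {x} x∈c qₖ<x = begin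
      isEvenᵇ (toℕ (position q x))                ≡⟨ parity-flip x∈c (≢-sym (ℚ.<⇒≢ qₖ<x)) ⟩
      not (isEvenᵇ (rank (x ∷ tabulate q) (q k)))
        ≡⟨ cong (not ∘ isEvenᵇ) (trans (rank-∷-≮ _ (ℚ.<-asym qₖ<x)) rank-split-point) ⟩
      not (isEvenᵇ (toℕ k))                       ∎
      where open ≡-Reasoning

    weights-by-side : ∀ (g : Bool → Bool) → let b = isEvenᵇ (toℕ k) in
      sum (map (weight (g ∘ isEvenᵇ) q) (col C c))
        ≡ rank (col C c) (q k) * 𝟙 (g b) + above (col C c) (q k) * 𝟙 (g (not b))
    weights-by-side g =
      sum-map-by-side (weight (g ∘ isEvenᵇ) q) (q k) (col C c) on-below on-above (weight-split (g ∘ isEvenᵇ) increasing k)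
      where
      on-below : ∀ {x} → x ∈ col C c → x < q k → weight (g ∘ isEvenᵇ) q x ≡ 𝟙 (g (isEvenᵇ (toℕ k)))
      on-below x∈c x<qₖ =
        trans (weight-gap (g ∘ isEvenᵇ) increasing (gap x∈c (ℚ.<⇒≢ x<qₖ)))
              (cong (𝟙 ∘ g) (parity-below x∈c x<qₖ))
      on-above : ∀ {x} → x ∈ col C c → q k < x → weight (g ∘ isEvenᵇ) q x ≡ 𝟙 (g (not (isEvenᵇ (toℕ k))))
      on-above x∈c qₖ<x =
        trans (weight-gap (g ∘ isEvenᵇ) increasing (gap x∈c (≢-sym (ℚ.<⇒≢ qₖ<x))))
              (cong (𝟙 ∘ g) (parity-above x∈c qₖ<x))

    balanced⇔median : countPlus q (col C c) ≡ countMinus q (col C c) ⇔ IsMedian (col C c) (q k)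
    balanced⇔median = by-parity (isEvenᵇ (toℕ k))
      (trans (countPlus≡sum-weight q (col C c)) (weights-by-side (λ b → b)))
      (trans (countMinus≡sum-weight q (col C c)) (weights-by-side not))
      where
      R A : ℕ
      R = rank (col C c) (q k)
      A = above (col C c) (q k)
      R*1+A*0≡R : R * 1 + A * 0 ≡ R
      R*1+A*0≡R = trans (cong₂ _+_ (ℕ.*-identityʳ R) (ℕ.*-zeroʳ A)) (ℕ.+-identityʳ R)
      R*0+A*1≡A : R * 0 + A * 1 ≡ A
      R*0+A*1≡A = cong₂ _+_ (ℕ.*-zeroʳ R) (ℕ.*-identityʳ A)
      by-parity : ∀ {P M} b → P ≡ R * 𝟙 b + A * 𝟙 (not b) → M ≡ R * 𝟙 (not b) + A * 𝟙 (not (not b)) →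
        P ≡ M ⇔ IsMedian (col C c) (q k)
      by-parity true  P≡ M≡ =
        let P≡R = trans P≡ R*1+A*0≡R; M≡A = trans M≡ R*0+A*1≡A
        in mk⇔ (λ P≡M → qₖ∈c , trans (sym P≡R) (trans P≡M M≡A))
               (λ (_ , R≡A) → trans P≡R (trans R≡A (sym M≡A)))
      by-parity false P≡ M≡ =
        let P≡A = trans P≡ R*0+A*1≡A; M≡R = trans M≡ R*1+A*0≡R
        in mk⇔ (λ P≡M → qₖ∈c , trans (sym M≡R) (trans (sym P≡M) P≡A))
               (λ (_ , R≡A) → trans P≡A (trans (sym R≡A) (sym M≡R)))

  module Solutions (sep : Separable n C) (odd-sizes : ∀ c → length (col C c) % 2 ≡ 1) where

    solution-hits-colour : ∀ {q} → IsSolution C q → ∀ c → ∃ λ k → q k ∈ col C c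
    solution-hits-colour {q} (inc , balanced) c with Fin.any? (λ k → q k ∈? col C c)
    ... | yes hit = hit
    ... | no miss = contradiction (trans (sym even-length) (%2≡1⇒isEvenᵇ≡false (length (col C c)) (odd-sizes c))) λ ()
      where
      gaps : ∀ {x} → x ∈ col C c → ∀ i → q i ≢ x
      gaps x∈c i qᵢ≡x = miss (i , subst (_∈ col C c) (sym qᵢ≡x) x∈c)
      even-length : isEvenᵇ (length (col C c)) ≡ true
      even-length = begin
        isEvenᵇ (length (col C c))
          ≡⟨ cong isEvenᵇ (sym (countPlus+countMinus≡length inc (col C c) gaps)) ⟩
        isEvenᵇ (countPlus q (col C c) + countMinus q (col C c))
          ≡⟨ cong (λ m → isEvenᵇ (m + countMinus q (col C c))) (balanced c) ⟩
        isEvenᵇ (countMinus q (col C c) + countMinus q (col C c))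
          ≡⟨ isEvenᵇ-double (countMinus q (col C c)) ⟩
        true ∎
        where open ≡-Reasoning

    solution⇒splitsOnDistinctColours : ∀ {q} → IsSolution C q → SplitsOnDistinctColours q
    solution⇒splitsOnDistinctColours {q} sol = record
      { increasing       = proj₁ sol
      ; coloured         = λ i → let (c , hit≡i) = hit-onto i in c , on-colour c i hit≡i
      ; colour-injective = λ qᵢ∈e qⱼ∈e → trans (index≡hit qᵢ∈e) (sym (index≡hit qⱼ∈e))
      }
      where
      hit : Fin n → Fin n
      hit c = proj₁ (solution-hits-colour sol c)
      hit∈ : ∀ c → q (hit c) ∈ col C c
      hit∈ c = proj₂ (solution-hits-colour sol c)
      hit-onto : ∀ i → ∃ λ c → hit c ≡ i
      hit-onto = injective⇒surjective hit λ {c} {d} hit≡ →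
        same-colour (hit∈ c) (subst (λ i → q i ∈ col C d) (sym hit≡) (hit∈ d))
      on-colour : ∀ c i → hit c ≡ i → q i ∈ col C c
      on-colour c i hit≡i = subst (λ j → q j ∈ col C c) hit≡i (hit∈ c)
      index≡hit : ∀ {i e} → q i ∈ col C e → i ≡ hit e
      index≡hit {i} qᵢ∈e =
        let (c , hit≡i) = hit-onto i in trans (sym hit≡i) (cong hit (same-colour (on-colour c i hit≡i) qᵢ∈e))

    median-of : ∀ c → ∃ (IsMedian (col C c))
    median-of c =
      let (h , length≡) = %2≡1⇒odd (length (col C c)) (odd-sizes c) in median-exists {h = h} (unique C c) length≡

    median : Fin n → ℚ
    median c = proj₁ (median-of c)

    median∈ : ∀ c → median c ∈ col C c
    median∈ c = proj₁ (proj₂ (median-of c))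

    medians : List ℚ
    medians = tabulate median

    split-at-median : ∀ {q} → SplitsOnDistinctColours q → (∀ c → countPlus q (col C c) ≡ countMinus q (col C c)) →
      ∀ {k c} → q k ∈ col C c → q k ≡ median c
    split-at-median splits balanced {c = c} qₖ∈c =
      median-unique (unique C c) (Equivalence.to (SplitOnColour.balanced⇔median sep splits qₖ∈c) (balanced c))
                    (proj₂ (median-of c))

    medians-distinct : ∀ {c d} → median c ≡ median d → c ≡ d
    medians-distinct {c} {d} mc≡md = same-colour (median∈ c) (subst (_∈ col C d) (sym mc≡md) (median∈ d))

    sorted : Σ (Fin n → ℚ) (IncreasingEnumeration medians)
    sorted = increasing-enumeration (Unique-tabulate⁺ medians-distinct) (length-tabulate median)

    sortedMedians : Fin n → ℚ
    sortedMedians = proj₁ sorted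

    open IncreasingEnumeration (proj₂ sorted)

    sortedMedians-at-median : ∀ {i e} → sortedMedians i ∈ col C e → sortedMedians i ≡ median e
    sortedMedians-at-median {i} qᵢ∈e =
      let (c , qᵢ≡mc) = ∈-tabulate⁻ (member i)
      in trans qᵢ≡mc (cong median (same-colour (median∈ c) (subst (_∈ col C _) qᵢ≡mc qᵢ∈e)))

    sortedMedians-splits : SplitsOnDistinctColours sortedMedians
    sortedMedians-splits = record
      { increasing       = increasing
      ; coloured         = λ i → let (c , qᵢ≡mc) = ∈-tabulate⁻ (member i)
                                 in c , subst (_∈ col C c) (sym qᵢ≡mc) (median∈ c)
      ; colour-injective = λ qᵢ∈e qⱼ∈e →
          increasing-injective increasing (trans (sortedMedians-at-median qᵢ∈e) (sym (sortedMedians-at-median qⱼ∈e)))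
      }

    sortedMedians-solution : IsSolution C sortedMedians
    sortedMedians-solution = increasing , balanced
      where
      balanced : ∀ c → countPlus sortedMedians (col C c) ≡ countMinus sortedMedians (col C c)
      balanced c =
        let (k , qₖ≡mc) = onto (∈-tabulate⁺ c)
            qₖ∈c = subst (_∈ col C c) (sym qₖ≡mc) (median∈ c)
        in Equivalence.from (SplitOnColour.balanced⇔median sep sortedMedians-splits qₖ∈c)
             (subst (IsMedian (col C c)) (sym qₖ≡mc) (proj₂ (median-of c)))

    solution≡sortedMedians : ∀ q′ → IsSolution C q′ → ∀ i → q′ i ≡ sortedMedians i
    solution≡sortedMedians q′ sol′ = increasing-unique (proj₁ sol′) increasing q′⊆q q⊆q′
      where
      splits′ : SplitsOnDistinctColours q′
      splits′ = solution⇒splitsOnDistinctColours sol′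
      q′-at-median : ∀ {i c} → q′ i ∈ col C c → q′ i ≡ median c
      q′-at-median = split-at-median splits′ (proj₂ sol′)
      q′⊆q : ∀ i → ∃ λ j → q′ i ≡ sortedMedians j
      q′⊆q i = let (c , q′ᵢ∈c) = SplitsOnDistinctColours.coloured splits′ i
                   (j , qⱼ≡q′ᵢ) = onto (subst (_∈ medians) (sym (q′-at-median q′ᵢ∈c)) (∈-tabulate⁺ c))
               in j , sym qⱼ≡q′ᵢ
      q⊆q′ : ∀ j → ∃ λ i → sortedMedians j ≡ q′ i
      q⊆q′ j = let (c , qⱼ≡mc) = ∈-tabulate⁻ (member j)
                   (i , q′ᵢ∈c) = solution-hits-colour sol′ c
               in i , trans qⱼ≡mc (sym (q′-at-median q′ᵢ∈c))

theorem7 : (n : ℕ) (C : Necklace n) → Separable n C → (∀ (c : Fin n) → length (col C c) % 2 ≡ 1) →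
    Σ (Fin n → ℚ) (λ q → IsSolution C q × (∀ (q′ : Fin n → ℚ) → IsSolution C q′ → ∀ i → q′ i ≡ q i))
theorem7 n C sep odd-sizes = sortedMedians , sortedMedians-solution , solution≡sortedMedians
  where open Solutions C sep odd-sizes
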